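{- Let $d\geq 1$, $r\geq d+1$, $1\leq m\leq r$ and $m\leq k\leq \min\{m+d,r\}$ be integers. Let $V$ be a finite set with $|V|\geq \max\{m+d,r\}$. Let $X$ be a $d$-collapsible simplicial complex on vertex set $V$, and let $M$ be a matroid of rank $r$ on $V$ with rank function $\rho$. Assume that for every set $U=\{u_1,\ldots,u_d,v_1,\ldots,v_m\}\subset V$ (of $d+m$ distinct elements) with $\rho(U)\geq k$, there is some $i\in\{1,\ldots,m\}$ such that $\{u_1,\ldots,u_d,v_i\}\in X$. Then there is some $\tau\in X$ such that $\rho(\tau)\geq r+1-m$ and $\rho(V\setminus \tau)\leq k-1$.
   Context: A simplicial complex $X$ on vertex set $V$ is a family of subsets of the finite set $V$ closed under taking subsets; its elements are simplices (faces). A simplex $\sigma\in X$ is a free face if it is contained in a unique maximal face of $X$. If $\sigma$ is a free face with $|\sigma|\leq d$, an elementary $d$-collapse removes from $X$ all simplices containing $\sigma$. $X$ is $d$-collapsible if some sequence of elementary $d$-collapses reduces $X$ to the void complex $\emptyset$. For a matroid $M$ on $V$, the rank function $\rho$ assigns to $W\subset V$ the maximum size of an independent subset of $W$; the rank of $M$ is $\rho(V)$. -}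

module Defs where

open import Data.Nat using (ℕ; zero; suc; _+_; _≤_; _<_; _⊔_)
open import Data.Bool using (Bool; true; false)
open import Data.Vec using (_∷_; [])
open import Data.List using (List; []; _∷_; map; filter; foldr; _++_)
open import Data.Fin using (Fin)
open import Data.Fin.Subset using (Subset; _⊆_; _∈_; _∉_; _∪_; ⁅_⁆; ∣_∣; ⊥; outside; inside)
open import Data.Fin.Subset.Properties using (_⊆?_)
open import Data.Product using (Σ; ∃; _×_; _,_)
open import Relation.Nullary using (¬_; Dec)
open import Relation.Nullary.Decidable using (_×-dec_)
open import Relation.Binary.PropositionalEquality using (_≡_)
open import Level using (Level; 0ℓ) renaming (suc to lsuc)

Family : ℕ → Set₁
Family n = Subset n → Set

record SimplicialComplex (n : ℕ) : Set₁ where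
  field
    face     : Family n
    downward : ∀ {σ τ} → σ ⊆ τ → face τ → face σ

IsMaximal : ∀ {n} → Family n → Subset n → Set
IsMaximal X τ = X τ × (∀ τ' → X τ' → τ ⊆ τ' → τ' ≡ τ)

IsFree : ∀ {n} → Family n → Subset n → Set
IsFree X σ = X σ × Σ (Subset _) (λ τ → (IsMaximal X τ × σ ⊆ τ)
                     × (∀ τ' → IsMaximal X τ' → σ ⊆ τ' → τ' ≡ τ))

removeStar : ∀ {n} → Family n → Subset n → Family n
removeStar X σ τ = X τ × ¬ (σ ⊆ τ)

-- X is d-collapsible: a sequence of elementary d-collapses reduces X
-- to the void complex (no faces at all, not even the empty face)
data Collapsible {n : ℕ} (d : ℕ) : Family n → Set₁ where
  void : ∀ X → (∀ τ → ¬ X τ) → Collapsible d X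
  step : ∀ X σ → IsFree X σ → ∣ σ ∣ ≤ d →
         Collapsible d (removeStar X σ) → Collapsible d X

DCollapsible : ∀ {n} → ℕ → SimplicialComplex n → Set₁
DCollapsible d X = Collapsible d (SimplicialComplex.face X)

record Matroid (n : ℕ) : Set₁ where
  field
    Indep      : Subset n → Set
    indep?     : ∀ I → Dec (Indep I)
    indep-⊥    : Indep ⊥
    hereditary : ∀ {I J} → I ⊆ J → Indep J → Indep I
    augment    : ∀ {I J} → Indep I → Indep J → ∣ I ∣ < ∣ J ∣ →
                 ∃ λ x → x ∈ J × x ∉ I × Indep (I ∪ ⁅ x ⁆)

allSubsets : (n : ℕ) → List (Subset n)
allSubsets zero = [] ∷ []
allSubsets (suc n) = map (outside ∷_) (allSubsets n) ++ map (inside ∷_) (allSubsets n)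

maximum : List ℕ → ℕ
maximum = foldr _⊔_ 0

rank : ∀ {n} → Matroid n → Subset n → ℕ
rank {n} M W = maximum (map ∣_∣ (filter (λ I → (I ⊆? W) ×-dec Matroid.indep? M I) (allSubsets n)))

-- Induction along the collapse sequence.  Call τ a target if ρ(τ) ≥ r + 1 − m and ρ(V ∖ τ) ≤ k − 1.
-- Collapse a free face σ, |σ| ≤ d, whose unique maximal face η is not a target, so that ρ(V ∖ η) ≥ k
-- or ρ(η) ≤ r − m.  If some pair (A, B) of the hypothesis had only removed witnesses A ∪ {v}, such a
-- witness contains σ and hence lies in η; matroid augmentation then gives a d-set A' with σ ⊆ A' ⊆ η
-- and an m-set B' ⊆ V ∖ η with ρ(A' ∪ B') ≥ k.  Every witness A' ∪ {v'} of the new pair contains σ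
-- but leaves η, which is impossible.  So the hypothesis survives the collapse.  The void complex
-- violates it (some pair has rank ≥ k, as k ≤ r and d + m ≤ |V|), hence some collapsed maximal face
-- is a target.

module Submission where

open import Defs
open import Data.Nat using (ℕ; suc; zero; _+_; _∸_; _≤_; _⊔_; _⊓_; z≤n; s≤s; _≤?_; _<?_)
open import Data.Nat.Properties
open import Data.Fin using () renaming (zero to fzero)
open import Data.Fin.Subset
  using (Subset; _∈_; _∉_; _⊆_; _⊂_; _⊃_; _∪_; _∩_; ⁅_⁆; ∣_∣; ∁; ⊤; Empty; inside; outside)
  renaming (⊥ to ∅)
open import Data.Fin.Subset.Properties
open import Data.Fin.Subset.Induction using (⊃-wellFounded)
open import Data.Vec using ([]; _∷_; here; there)
open import Data.List using ([]; _∷_; map; filter)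
open import Data.List.Membership.Propositional using () renaming (_∈_ to _∈ₗ_)
open import Data.List.Membership.Propositional.Properties using (∈-filter⁺; ∈-filter⁻; ∈-map⁺; ∈-++⁺ˡ; ∈-++⁺ʳ)
open import Data.List.Relation.Unary.Any using (here; there)
open import Data.Product using (∃; ∃₂; _×_; _,_; proj₁; proj₂)
open import Data.Sum using (_⊎_; inj₁; inj₂; [_,_])
import Data.Sum as Sum
open import Data.Empty using (⊥; ⊥-elim)
open import Induction.WellFounded using (Acc; acc)
open import Relation.Nullary using (¬_; yes; no)
open import Relation.Nullary.Decidable using (_×-dec_)
open import Relation.Binary.PropositionalEquality
  using (_≡_; refl; sym; trans; cong; cong₂; subst; subst₂; module ≡-Reasoning)

∪-lub : ∀ {n} {p q r : Subset n} → p ⊆ r → q ⊆ r → p ∪ q ⊆ r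
∪-lub {p = p} {q} p⊆r q⊆r x∈ = [ p⊆r , q⊆r ] (x∈p∪q⁻ p q x∈)

⊆∁⇒Empty : ∀ {n} {p q r : Subset n} → p ⊆ r → q ⊆ ∁ r → Empty (p ∩ q)
⊆∁⇒Empty {p = p} {q} p⊆r q⊆∁r (x , x∈p∩q) =
  x∈∁p⇒x∉p (q⊆∁r (proj₂ (x∈p∩q⁻ p q x∈p∩q))) (p⊆r (proj₁ (x∈p∩q⁻ p q x∈p∩q)))

x∉p⇒Empty[p∩⁅x⁆] : ∀ {n} {p : Subset n} {x} → x ∉ p → Empty (p ∩ ⁅ x ⁆)
x∉p⇒Empty[p∩⁅x⁆] {p = p} {x} x∉p (y , y∈) with x∈p∩q⁻ p ⁅ x ⁆ y∈
... | y∈p , y∈⁅x⁆ = x∉p (subst (_∈ p) (x∈⁅y⁆⇒x≡y x y∈⁅x⁆) y∈p)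

p⊆q∪[p∩∁q] : ∀ {n} (p q : Subset n) → p ⊆ q ∪ (p ∩ ∁ q)
p⊆q∪[p∩∁q] p q {x} x∈p with x ∈? q
... | yes x∈q = p⊆p∪q (p ∩ ∁ q) x∈q
... | no  x∉q = q⊆p∪q q (p ∩ ∁ q) (x∈p∩q⁺ (x∈p , x∉p⇒x∈∁p x∉q))

p⊆q∪r⇒p∩∁q⊆r : ∀ {n} {p q r : Subset n} → p ⊆ q ∪ r → p ∩ ∁ q ⊆ r
p⊆q∪r⇒p∩∁q⊆r {p = p} {q} {r} p⊆q∪r x∈p∩∁q with x∈p∩q⁻ p (∁ q) x∈p∩∁q
... | x∈p , x∈∁q = [ (λ x∈q → ⊥-elim (x∈∁p⇒x∉p x∈∁q x∈q)) , (λ x∈r → x∈r) ] (x∈p∪q⁻ q r (p⊆q∪r x∈p))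

p⊆q⇒p≡q⊎p⊂q : ∀ {n} {p q : Subset n} → p ⊆ q → p ≡ q ⊎ p ⊂ q
p⊆q⇒p≡q⊎p⊂q {p = []}          {[]}          _ = inj₁ refl
p⊆q⇒p≡q⊎p⊂q {p = inside ∷ p}  {outside ∷ q} h with h here
... | ()
p⊆q⇒p≡q⊎p⊂q {p = outside ∷ p} {inside ∷ q}  h = inj₂ (out⊂in (drop-∷-⊆ h))
p⊆q⇒p≡q⊎p⊂q {p = inside ∷ p}  {inside ∷ q}  h =
  Sum.map (cong (inside ∷_)) s⊂s (p⊆q⇒p≡q⊎p⊂q (drop-∷-⊆ h))
p⊆q⇒p≡q⊎p⊂q {p = outside ∷ p} {outside ∷ q} h =
  Sum.map (cong (outside ∷_)) s⊂s (p⊆q⇒p≡q⊎p⊂q (drop-∷-⊆ h))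

∣p∣≡∣p∩q∣+∣p∩∁q∣ : ∀ {n} (p q : Subset n) → ∣ p ∣ ≡ ∣ p ∩ q ∣ + ∣ p ∩ ∁ q ∣
∣p∣≡∣p∩q∣+∣p∩∁q∣ []            []            = refl
∣p∣≡∣p∩q∣+∣p∩∁q∣ (outside ∷ p) (_ ∷ q)       = ∣p∣≡∣p∩q∣+∣p∩∁q∣ p q
∣p∣≡∣p∩q∣+∣p∩∁q∣ (inside ∷ p)  (inside ∷ q)  = cong suc (∣p∣≡∣p∩q∣+∣p∩∁q∣ p q)
∣p∣≡∣p∩q∣+∣p∩∁q∣ (inside ∷ p)  (outside ∷ q) =
  trans (cong suc (∣p∣≡∣p∩q∣+∣p∩∁q∣ p q)) (sym (+-suc ∣ p ∩ q ∣ ∣ p ∩ ∁ q ∣))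

q⊆p⇒∣p∣≡∣q∣+∣p∩∁q∣ : ∀ {n} {p q : Subset n} → q ⊆ p → ∣ p ∣ ≡ ∣ q ∣ + ∣ p ∩ ∁ q ∣
q⊆p⇒∣p∣≡∣q∣+∣p∩∁q∣ {p = p} {q} q⊆p =
  trans (∣p∣≡∣p∩q∣+∣p∩∁q∣ p q) (cong (_+ ∣ p ∩ ∁ q ∣) ∣p∩q∣≡∣q∣)
  where
  ∣p∩q∣≡∣q∣ : ∣ p ∩ q ∣ ≡ ∣ q ∣
  ∣p∩q∣≡∣q∣ = ≤-antisym (∣p∩q∣≤∣q∣ p q) (p⊆q⇒∣p∣≤∣q∣ (λ x∈q → x∈p∩q⁺ (q⊆p x∈q , x∈q)))

Empty[p∩q]⇒∣p∪q∣≡∣p∣+∣q∣ : ∀ {n} (p q : Subset n) → Empty (p ∩ q) → ∣ p ∪ q ∣ ≡ ∣ p ∣ + ∣ q ∣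
Empty[p∩q]⇒∣p∪q∣≡∣p∣+∣q∣ []            []            _ = refl
Empty[p∩q]⇒∣p∪q∣≡∣p∣+∣q∣ (outside ∷ p) (outside ∷ q) e = Empty[p∩q]⇒∣p∪q∣≡∣p∣+∣q∣ p q (drop-∷-Empty e)
Empty[p∩q]⇒∣p∪q∣≡∣p∣+∣q∣ (inside ∷ p)  (outside ∷ q) e = cong suc (Empty[p∩q]⇒∣p∪q∣≡∣p∣+∣q∣ p q (drop-∷-Empty e))
Empty[p∩q]⇒∣p∪q∣≡∣p∣+∣q∣ (outside ∷ p) (inside ∷ q)  e =
  trans (cong suc (Empty[p∩q]⇒∣p∪q∣≡∣p∣+∣q∣ p q (drop-∷-Empty e))) (sym (+-suc ∣ p ∣ ∣ q ∣))
Empty[p∩q]⇒∣p∪q∣≡∣p∣+∣q∣ (inside ∷ p)  (inside ∷ q)  e = ⊥-elim (e (fzero , here))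

x∉p⇒∣p∪⁅x⁆∣≡1+∣p∣ : ∀ {n} {p : Subset n} {x} → x ∉ p → ∣ p ∪ ⁅ x ⁆ ∣ ≡ suc ∣ p ∣
x∉p⇒∣p∪⁅x⁆∣≡1+∣p∣ {p = p} {x} x∉p = begin
  ∣ p ∪ ⁅ x ⁆ ∣     ≡⟨ Empty[p∩q]⇒∣p∪q∣≡∣p∣+∣q∣ p ⁅ x ⁆ (x∉p⇒Empty[p∩⁅x⁆] x∉p) ⟩
  ∣ p ∣ + ∣ ⁅ x ⁆ ∣ ≡⟨ cong (∣ p ∣ +_) (∣⁅x⁆∣≡1 x) ⟩
  ∣ p ∣ + 1         ≡⟨ +-comm ∣ p ∣ 1 ⟩
  suc ∣ p ∣         ∎
  where open ≡-Reasoning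

∣p∣≤∣p∩q∣+m : ∀ {n} {p q u : Subset n} m → p ⊆ u → q ⊆ u → ∣ u ∣ ≡ ∣ q ∣ + m → ∣ p ∣ ≤ ∣ p ∩ q ∣ + m
∣p∣≤∣p∩q∣+m {p = p} {q} {u} m p⊆u q⊆u ∣u∣≡ = begin
  ∣ p ∣                     ≡⟨ ∣p∣≡∣p∩q∣+∣p∩∁q∣ p q ⟩
  ∣ p ∩ q ∣ + ∣ p ∩ ∁ q ∣   ≤⟨ +-monoʳ-≤ ∣ p ∩ q ∣ (p⊆q⇒∣p∣≤∣q∣ (λ x∈ → x∈p∩q⁺ (p⊆u (p∩q⊆p p (∁ q) x∈) , p∩q⊆q p (∁ q) x∈))) ⟩
  ∣ p ∩ q ∣ + ∣ u ∩ ∁ q ∣   ≡⟨ cong (∣ p ∩ q ∣ +_) ∣u∩∁q∣≡m ⟩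
  ∣ p ∩ q ∣ + m             ∎
  where
  open ≤-Reasoning
  ∣u∩∁q∣≡m : ∣ u ∩ ∁ q ∣ ≡ m
  ∣u∩∁q∣≡m = +-cancelˡ-≡ ∣ q ∣ _ _ (trans (sym (q⊆p⇒∣p∣≡∣q∣+∣p∩∁q∣ q⊆u)) ∣u∣≡)

between-of-size : ∀ {n} {p q : Subset n} j → p ⊆ q → ∣ p ∣ ≤ j → j ≤ ∣ q ∣ →
                  ∃ λ r → p ⊆ r × r ⊆ q × ∣ r ∣ ≡ j
between-of-size {p = []} {[]} j _ _ j≤0 = [] , (λ x∈ → x∈) , (λ x∈ → x∈) , sym (n≤0⇒n≡0 j≤0)
between-of-size {p = inside ∷ p} {outside ∷ q} j h _ _ with h here
... | ()
between-of-size {p = outside ∷ p} {outside ∷ q} j h ∣p∣≤j j≤∣q∣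
  with between-of-size j (drop-∷-⊆ h) ∣p∣≤j j≤∣q∣
... | r , p⊆r , r⊆q , ∣r∣≡j = outside ∷ r , out⊆ p⊆r , out⊆ r⊆q , ∣r∣≡j
between-of-size {p = inside ∷ p} {inside ∷ q} (suc j) h (s≤s ∣p∣≤j) (s≤s j≤∣q∣)
  with between-of-size j (drop-∷-⊆ h) ∣p∣≤j j≤∣q∣
... | r , p⊆r , r⊆q , ∣r∣≡j = inside ∷ r , in⊆in p⊆r , in⊆in r⊆q , cong suc ∣r∣≡j
between-of-size {p = outside ∷ p} {inside ∷ q} j h ∣p∣≤j j≤1+∣q∣ with j ≤? ∣ q ∣
... | yes j≤∣q∣ with between-of-size j (drop-∷-⊆ h) ∣p∣≤j j≤∣q∣
...   | r , p⊆r , r⊆q , ∣r∣≡j = outside ∷ r , out⊆ p⊆r , out⊆ r⊆q , ∣r∣≡j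
between-of-size {p = outside ∷ p} {inside ∷ q} j h ∣p∣≤j j≤1+∣q∣ | no j≰∣q∣ =
  inside ∷ q , out⊆ (drop-∷-⊆ h) , ⊆-refl , ≤-antisym (≰⇒> j≰∣q∣) j≤1+∣q∣

split-of-size : ∀ {n} {t : Subset n} d m → ∣ t ∣ ≡ d + m →
                ∃₂ λ a b → Empty (a ∩ b) × ∣ a ∣ ≡ d × ∣ b ∣ ≡ m × t ⊆ a ∪ b
split-of-size {n} {t} d m ∣t∣≡ with between-of-size d (⊥⊆ {p = t}) (subst (_≤ d) (sym (∣⊥∣≡0 n)) z≤n)
                                       (subst (d ≤_) (sym ∣t∣≡) (m≤m+n d m))
... | a , _ , a⊆t , ∣a∣≡d =
  a , t ∩ ∁ a , ⊆∁⇒Empty ⊆-refl (p∩q⊆q t (∁ a)) , ∣a∣≡d , ∣t∩∁a∣≡m , p⊆q∪[p∩∁q] t a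
  where
  ∣t∩∁a∣≡m : ∣ t ∩ ∁ a ∣ ≡ m
  ∣t∩∁a∣≡m = +-cancelˡ-≡ d _ _ (trans (cong (_+ ∣ t ∩ ∁ a ∣) (sym ∣a∣≡d)) (trans (sym (q⊆p⇒∣p∣≡∣q∣+∣p∩∁q∣ a⊆t)) ∣t∣≡))

∈-allSubsets : ∀ {n} (p : Subset n) → p ∈ₗ allSubsets n
∈-allSubsets []                = here refl
∈-allSubsets {suc n} (outside ∷ p) = ∈-++⁺ˡ (∈-map⁺ (outside ∷_) (∈-allSubsets p))
∈-allSubsets {suc n} (inside ∷ p)  = ∈-++⁺ʳ (map (outside ∷_) (allSubsets n)) (∈-map⁺ (inside ∷_) (∈-allSubsets p))

module _ {A : Set} (f : A → ℕ) where

  ≤-maximum-map : ∀ {x xs} → x ∈ₗ xs → f x ≤ maximum (map f xs)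
  ≤-maximum-map {xs = y ∷ ys} (here refl) = m≤m⊔n (f y) (maximum (map f ys))
  ≤-maximum-map {xs = y ∷ ys} (there x∈) = ≤-trans (≤-maximum-map x∈) (m≤n⊔m (f y) (maximum (map f ys)))

  maximum-map-attained : ∀ xs → maximum (map f xs) ≡ 0 ⊎ ∃ λ x → x ∈ₗ xs × maximum (map f xs) ≡ f x
  maximum-map-attained []       = inj₁ refl
  maximum-map-attained (x ∷ xs) with ⊔-sel (f x) (maximum (map f xs))
  ... | inj₁ max≡fx = inj₂ (x , here refl , max≡fx)
  ... | inj₂ max≡rest with maximum-map-attained xs
  ...   | inj₁ rest≡0 = inj₁ (trans max≡rest rest≡0)
  ...   | inj₂ (y , y∈ , rest≡fy) = inj₂ (y , there y∈ , trans max≡rest rest≡fy)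

module _ {n : ℕ} (M : Matroid n) where
  open Matroid M

  ∣I∣≤rank : ∀ {I W} → Indep I → I ⊆ W → ∣ I ∣ ≤ rank M W
  ∣I∣≤rank {I} {W} iI I⊆W =
    ≤-maximum-map ∣_∣ (∈-filter⁺ (λ J → (J ⊆? W) ×-dec indep? J) (∈-allSubsets I) (I⊆W , iI))

  rank-attained : ∀ W → ∃ λ I → Indep I × I ⊆ W × ∣ I ∣ ≡ rank M W
  rank-attained W with maximum-map-attained ∣_∣ (filter (λ J → (J ⊆? W) ×-dec indep? J) (allSubsets n))
  ... | inj₁ rank≡0 = ∅ , indep-⊥ , ⊥⊆ , trans (∣⊥∣≡0 n) (sym rank≡0)
  ... | inj₂ (I , I∈ , rank≡∣I∣) with ∈-filter⁻ (λ J → (J ⊆? W) ×-dec indep? J) {xs = allSubsets n} I∈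
  ...   | _ , I⊆W , iI = I , iI , I⊆W , sym rank≡∣I∣

  indep-of-size : ∀ {W} j → j ≤ rank M W → ∃ λ I → Indep I × I ⊆ W × ∣ I ∣ ≡ j
  indep-of-size {W} j j≤rank =
    let I , iI , I⊆W , ∣I∣≡rank = rank-attained W
        J , _ , J⊆I , ∣J∣≡j     = between-of-size j ⊥⊆ (subst (_≤ j) (sym (∣⊥∣≡0 n)) z≤n)
                                    (subst (j ≤_) (sym ∣I∣≡rank) j≤rank)
    in J , hereditary J⊆I iI , ⊆-trans J⊆I I⊆W , ∣J∣≡j

  augment-to : ∀ {K T} j → Indep K → Indep T → ∣ K ∣ ≤ j → j ≤ ∣ T ∣ →
               ∃ λ L → Indep L × K ⊆ L × L ⊆ K ∪ T × ∣ L ∣ ≡ j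
  augment-to {K} {T} j iK iT ∣K∣≤j j≤∣T∣ =
    subst (λ i → ∃ λ L → Indep L × K ⊆ L × L ⊆ K ∪ T × ∣ L ∣ ≡ i) (m∸n+n≡m ∣K∣≤j)
      (augment-by (j ∸ ∣ K ∣) iK (subst (_≤ ∣ T ∣) (sym (m∸n+n≡m ∣K∣≤j)) j≤∣T∣))
    where
    augment-by : ∀ g {K} → Indep K → g + ∣ K ∣ ≤ ∣ T ∣ →
                 ∃ λ L → Indep L × K ⊆ L × L ⊆ K ∪ T × ∣ L ∣ ≡ g + ∣ K ∣
    augment-by zero    {K} iK _ = K , iK , ⊆-refl , p⊆p∪q T , refl
    augment-by (suc g) {K} iK g+1+∣K∣≤∣T∣ with augment iK iT (≤-trans (s≤s (m≤n+m ∣ K ∣ g)) g+1+∣K∣≤∣T∣)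
    ... | x , x∈T , x∉K , iKx = extend (augment-by g iKx (subst (_≤ ∣ T ∣) (sym g+∣Kx∣≡) g+1+∣K∣≤∣T∣))
      where
      g+∣Kx∣≡ : g + ∣ K ∪ ⁅ x ⁆ ∣ ≡ suc g + ∣ K ∣
      g+∣Kx∣≡ = trans (cong (g +_) (x∉p⇒∣p∪⁅x⁆∣≡1+∣p∣ x∉K)) (+-suc g ∣ K ∣)
      Kx∪T⊆K∪T : (K ∪ ⁅ x ⁆) ∪ T ⊆ K ∪ T
      Kx∪T⊆K∪T = ∪-lub (∪-lub (p⊆p∪q T) (λ y∈⁅x⁆ → q⊆p∪q K T (subst (_∈ T) (sym (x∈⁅y⁆⇒x≡y x y∈⁅x⁆)) x∈T)))
                       (q⊆p∪q K T)
      extend : (∃ λ L → Indep L × K ∪ ⁅ x ⁆ ⊆ L × L ⊆ (K ∪ ⁅ x ⁆) ∪ T × ∣ L ∣ ≡ g + ∣ K ∪ ⁅ x ⁆ ∣) →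
               ∃ λ L → Indep L × K ⊆ L × L ⊆ K ∪ T × ∣ L ∣ ≡ suc g + ∣ K ∣
      extend (L , iL , Kx⊆L , L⊆Kx∪T , ∣L∣≡) =
        L , iL , ⊆-trans (p⊆p∪q ⁅ x ⁆) Kx⊆L , ⊆-trans L⊆Kx∪T Kx∪T⊆K∪T , trans ∣L∣≡ g+∣Kx∣≡

  -- Augment K inside an independent k-subset I of W; the at most m elements gained lie in I and,
  -- padded inside I, form B.
  block-from-high-rank : ∀ {K A W} m k → Indep K → K ⊆ A → ∣ K ∣ ≤ k → k ≤ ∣ K ∣ + m → m ≤ k →
                         k ≤ rank M W → ∃ λ B → B ⊆ W × ∣ B ∣ ≡ m × k ≤ rank M (A ∪ B)
  block-from-high-rank {K} {A} m k iK K⊆A ∣K∣≤k k≤∣K∣+m m≤k k≤rank =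
    let I , iI , I⊆W , ∣I∣≡k          = indep-of-size k k≤rank
        L , iL , K⊆L , L⊆K∪I , ∣L∣≡k = augment-to k iK iI ∣K∣≤k (≤-reflexive (sym ∣I∣≡k))
        ∣gained∣≤m = +-cancelˡ-≤ ∣ K ∣ _ _
          (subst (_≤ ∣ K ∣ + m) (trans (sym ∣L∣≡k) (q⊆p⇒∣p∣≡∣q∣+∣p∩∁q∣ K⊆L)) k≤∣K∣+m)
        B , gained⊆B , B⊆I , ∣B∣≡m =
          between-of-size m (p⊆q∪r⇒p∩∁q⊆r L⊆K∪I) ∣gained∣≤m (≤-trans m≤k (≤-reflexive (sym ∣I∣≡k)))
        L⊆A∪B = ⊆-trans (p⊆q∪[p∩∁q] L K) (∪-lub (⊆-trans K⊆A (p⊆p∪q B)) (⊆-trans gained⊆B (q⊆p∪q A B)))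
    in B , ⊆-trans B⊆I I⊆W , ∣B∣≡m , subst (_≤ rank M (A ∪ B)) ∣L∣≡k (∣I∣≤rank iL L⊆A∪B)

  -- Extend K to a basis L; as ρ(η) ≤ ρ(V) − m, at least m elements of L lie outside η.
  block-from-low-rank : ∀ {K A η} m k → Indep K → K ⊆ A → A ⊆ η → k ≤ ∣ K ∣ + m →
                        rank M η + m ≤ rank M ⊤ → ∃ λ B → B ⊆ ∁ η × ∣ B ∣ ≡ m × k ≤ rank M (A ∪ B)
  block-from-low-rank {K} {A} {η} m k iK K⊆A A⊆η k≤∣K∣+m rank[η]+m≤r =
    let Bs , iBs , _ , ∣Bs∣≡r     = rank-attained ⊤
        L , iL , K⊆L , _ , ∣L∣≡r = augment-to (rank M ⊤) iK iBs (∣I∣≤rank iK ⊆⊤) (≤-reflexive (sym ∣Bs∣≡r))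
        B , _ , B⊆L∖η , ∣B∣≡m    = between-of-size m ⊥⊆ (subst (_≤ m) (sym (∣⊥∣≡0 n)) z≤n) (m≤∣L∖η∣ iL ∣L∣≡r)
        B⊆∁η = ⊆-trans B⊆L∖η (p∩q⊆q L (∁ η))
        K∪B⊆L = ∪-lub K⊆L (⊆-trans B⊆L∖η (p∩q⊆p L (∁ η)))
        ∣K∪B∣≡∣K∣+m = trans (Empty[p∩q]⇒∣p∪q∣≡∣p∣+∣q∣ K B (⊆∁⇒Empty (⊆-trans K⊆A A⊆η) B⊆∁η))
                            (cong (∣ K ∣ +_) ∣B∣≡m)
        K∪B⊆A∪B = ∪-lub (⊆-trans K⊆A (p⊆p∪q B)) (q⊆p∪q A B)
    in B , B⊆∁η , ∣B∣≡m ,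
       ≤-trans k≤∣K∣+m (subst (_≤ rank M (A ∪ B)) ∣K∪B∣≡∣K∣+m (∣I∣≤rank (hereditary K∪B⊆L iL) K∪B⊆A∪B))
    where
    m≤∣L∖η∣ : ∀ {L} → Indep L → ∣ L ∣ ≡ rank M ⊤ → m ≤ ∣ L ∩ ∁ η ∣
    m≤∣L∖η∣ {L} iL ∣L∣≡r = +-cancelˡ-≤ (rank M η) _ _ (begin
      rank M η + m             ≤⟨ rank[η]+m≤r ⟩
      rank M ⊤                 ≡⟨ sym ∣L∣≡r ⟩
      ∣ L ∣                    ≡⟨ ∣p∣≡∣p∩q∣+∣p∩∁q∣ L η ⟩
      ∣ L ∩ η ∣ + ∣ L ∩ ∁ η ∣  ≤⟨ +-monoˡ-≤ _ (∣I∣≤rank (hereditary (p∩q⊆p L η) iL) (p∩q⊆q L η)) ⟩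
      rank M η + ∣ L ∩ ∁ η ∣   ∎)
      where open ≤-Reasoning

module _ {n : ℕ} (Y : Family n) where

  extend-to-maximal : ∀ {φ} → Y φ → ¬ ¬ (∃ λ τ → IsMaximal Y τ × φ ⊆ τ)
  extend-to-maximal {φ} = go φ (⊃-wellFounded φ)
    where
    go : ∀ φ → Acc _⊃_ φ → Y φ → ¬ ¬ (∃ λ τ → IsMaximal Y τ × φ ⊆ τ)
    go φ (acc above) yφ no-max = no-max (φ , (yφ , maximal) , ⊆-refl)
      where
      maximal : ∀ τ → Y τ → φ ⊆ τ → τ ≡ φ
      maximal τ yτ φ⊆τ with p⊆q⇒p≡q⊎p⊂q φ⊆τ
      ... | inj₁ φ≡τ = sym φ≡τ
      ... | inj₂ φ⊂τ = ⊥-elim (go τ (above φ⊂τ) yτ (λ { (τ' , τ'-max , τ⊆τ') → no-max (τ' , τ'-max , ⊆-trans φ⊆τ τ⊆τ') }))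

  ⊆-unique-maximal : ∀ {σ η} → (∀ τ → IsMaximal Y τ → σ ⊆ τ → τ ≡ η) →
                     ∀ {φ} → Y φ → σ ⊆ φ → ¬ ¬ (φ ⊆ η)
  ⊆-unique-maximal uniq yφ σ⊆φ φ⊈η =
    extend-to-maximal yφ (λ { (τ , τ-max , φ⊆τ) → φ⊈η (subst (_ ⊆_) (uniq τ τ-max (⊆-trans σ⊆φ φ⊆τ)) φ⊆τ) })

  no-face-leaving : ∀ {σ η} → (∀ τ → IsMaximal Y τ → σ ⊆ τ → τ ≡ η) →
                    ∀ {A B} → σ ⊆ A → B ⊆ ∁ η → ¬ (∃ λ v → v ∈ B × Y (A ∪ ⁅ v ⁆))
  no-face-leaving uniq {A} σ⊆A B⊆∁η (v , v∈B , y[A+v]) =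
    ⊆-unique-maximal uniq y[A+v] (⊆-trans σ⊆A (p⊆p∪q ⁅ v ⁆))
      (λ A+v⊆η → x∈∁p⇒x∉p (B⊆∁η v∈B) (A+v⊆η (q⊆p∪q A ⁅ v ⁆ (x∈⁅x⁆ v))))

module _ {n : ℕ} (M : Matroid n) {d m k r : ℕ} (rank[⊤]≡r : rank M ⊤ ≡ r)
         (m≤k : m ≤ k) (k≤r : k ≤ r) (k≤d+m : k ≤ d + m) (d+m≤n : d + m ≤ n) where

  -- A face lies in a maximal one only classically, hence the double negation; the target face is
  -- still found explicitly, because being a target is decidable.
  Covered : Family n → Set
  Covered Y = ∀ A B → Empty (A ∩ B) → ∣ A ∣ ≡ d → ∣ B ∣ ≡ m → k ≤ rank M (A ∪ B) →
              ¬ ¬ (∃ λ v → v ∈ B × Y (A ∪ ⁅ v ⁆))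

  Target : Subset n → Set
  Target τ = r + 1 ∸ m ≤ rank M τ × rank M (∁ τ) ≤ k ∸ 1

  Deficient : Subset n → Set
  Deficient η = k ≤ rank M (∁ η) ⊎ rank M η + m ≤ r

  target-or-deficient : ∀ τ → Target τ ⊎ Deficient τ
  target-or-deficient τ with rank M (∁ τ) <? k | r <? rank M τ + m
  ... | no  k≰rank | _     = inj₂ (inj₁ (≮⇒≥ k≰rank))
  ... | yes _      | no r≮ = inj₂ (inj₂ (≮⇒≥ r≮))
  ... | yes rank<k | yes r<rank+m =
    inj₁ (m≤n+o⇒m∸n≤o (r + 1) m (subst₂ _≤_ (+-comm 1 r) (+-comm (rank M τ) m) r<rank+m) , ∸-monoˡ-≤ 1 rank<k)

  opposite-block : ∀ {η A U} → Deficient η → A ⊆ η → A ⊆ U → ∣ U ∣ ≡ ∣ A ∣ + m → k ≤ rank M U →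
                   ∃ λ B → B ⊆ ∁ η × ∣ B ∣ ≡ m × k ≤ rank M (A ∪ B)
  opposite-block {η} {A} {U} deficient A⊆η A⊆U ∣U∣≡ k≤rank with indep-of-size M k k≤rank
  ... | J , iJ , J⊆U , ∣J∣≡k =
    [ block-from-high-rank M m k iK (p∩q⊆q J A) ∣K∣≤k k≤∣K∣+m m≤k
    , (λ rank[η]+m≤r → block-from-low-rank M m k iK (p∩q⊆q J A) A⊆η k≤∣K∣+m
                          (subst (rank M η + m ≤_) (sym rank[⊤]≡r) rank[η]+m≤r))
    ] deficient
    where
    iK : Matroid.Indep M (J ∩ A)
    iK = Matroid.hereditary M (p∩q⊆p J A) iJ
    ∣K∣≤k : ∣ J ∩ A ∣ ≤ k
    ∣K∣≤k = subst (∣ J ∩ A ∣ ≤_) ∣J∣≡k (∣p∩q∣≤∣p∣ J A)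
    k≤∣K∣+m : k ≤ ∣ J ∩ A ∣ + m
    k≤∣K∣+m = subst (_≤ ∣ J ∩ A ∣ + m) ∣J∣≡k (∣p∣≤∣p∩q∣+m m J⊆U A⊆U ∣U∣≡)

  covered-removeStar : ∀ {Y σ η} → (∀ τ → IsMaximal Y τ → σ ⊆ τ → τ ≡ η) → ∣ σ ∣ ≤ d → Deficient η →
                       Covered Y → Covered (removeStar Y σ)
  covered-removeStar {Y} {σ} {η} uniq ∣σ∣≤d deficient cov A B A∩B=∅ ∣A∣≡d ∣B∣≡m k≤rank no-face =
    cov A B A∩B=∅ ∣A∣≡d ∣B∣≡m k≤rank (λ { (v , v∈B , y[A+v]) → face-survives v∈B y[A+v] })
    where
    not-inside-η : ∀ {v} → v ∈ B → σ ⊆ A ∪ ⁅ v ⁆ → ¬ (A ∪ ⁅ v ⁆ ⊆ η)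
    not-inside-η {v} v∈B σ⊆A+v A+v⊆η =
      let A' , σ⊆A' , A'⊆A+v , ∣A'∣≡d =
            between-of-size d σ⊆A+v ∣σ∣≤d (subst (_≤ ∣ A ∪ ⁅ v ⁆ ∣) ∣A∣≡d (∣p∣≤∣p∪q∣ A ⁅ v ⁆))
          A'⊆η = ⊆-trans A'⊆A+v A+v⊆η
          B' , B'⊆∁η , ∣B'∣≡m , k≤rank' =
            opposite-block deficient A'⊆η (⊆-trans A'⊆A+v A+v⊆A∪B)
              (trans (Empty[p∩q]⇒∣p∪q∣≡∣p∣+∣q∣ A B A∩B=∅) (cong₂ _+_ (trans ∣A∣≡d (sym ∣A'∣≡d)) ∣B∣≡m)) k≤rank
      in cov A' B' (⊆∁⇒Empty A'⊆η B'⊆∁η) ∣A'∣≡d ∣B'∣≡m k≤rank' (no-face-leaving Y uniq σ⊆A' B'⊆∁η)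
      where
      A+v⊆A∪B : A ∪ ⁅ v ⁆ ⊆ A ∪ B
      A+v⊆A∪B = ∪-lub (p⊆p∪q B) (λ x∈⁅v⁆ → q⊆p∪q A B (subst (_∈ B) (sym (x∈⁅y⁆⇒x≡y v x∈⁅v⁆)) v∈B))
    face-survives : ∀ {v} → v ∈ B → Y (A ∪ ⁅ v ⁆) → ⊥
    face-survives {v} v∈B y[A+v] with σ ⊆? A ∪ ⁅ v ⁆
    ... | no  σ⊈A+v = no-face (v , v∈B , y[A+v] , σ⊈A+v)
    ... | yes σ⊆A+v = ⊆-unique-maximal Y uniq y[A+v] σ⊆A+v (not-inside-η v∈B σ⊆A+v)

  void-uncovered : ∀ {Y} → (∀ τ → ¬ Y τ) → ¬ Covered Y
  void-uncovered no-faces cov =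
    let I , iI , _ , ∣I∣≡k = indep-of-size M k (subst (k ≤_) (sym rank[⊤]≡r) k≤r)
        T , I⊆T , _ , ∣T∣≡d+m =
          between-of-size (d + m) ⊆⊤ (subst (_≤ d + m) (sym ∣I∣≡k) k≤d+m) (subst (d + m ≤_) (sym (∣⊤∣≡n n)) d+m≤n)
        A , B , A∩B=∅ , ∣A∣≡d , ∣B∣≡m , T⊆A∪B = split-of-size d m ∣T∣≡d+m
        k≤rank = subst (_≤ rank M (A ∪ B)) ∣I∣≡k (∣I∣≤rank M iI (⊆-trans I⊆T T⊆A∪B))
    in cov A B A∩B=∅ ∣A∣≡d ∣B∣≡m k≤rank (λ { (_ , _ , y) → no-faces _ y })

  target-face : ∀ {Y} → Collapsible d Y → Covered Y → ∃ λ τ → Y τ × Target τ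
  target-face (void _ no-faces) cov = ⊥-elim (void-uncovered no-faces cov)
  target-face (step _ σ (_ , η , ((yη , _) , _) , uniq) ∣σ∣≤d rest) cov with target-or-deficient η
  ... | inj₁ η-target = η , yη , η-target
  ... | inj₂ deficient with target-face rest (covered-removeStar uniq ∣σ∣≤d deficient cov)
  ...   | τ , (yτ , _) , τ-target = τ , yτ , τ-target

theorem1p6 : (d r m k n : ℕ) →
    1 ≤ d → d + 1 ≤ r → 1 ≤ m → m ≤ r → m ≤ k → k ≤ (m + d) ⊓ r →
    (m + d) ⊔ r ≤ n →
    (X : SimplicialComplex n) → DCollapsible d X →
    (M : Matroid n) → rank M ⊤ ≡ r →
    (∀ (A B : Subset n) → Empty (A ∩ B) → ∣ A ∣ ≡ d → ∣ B ∣ ≡ m →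
       k ≤ rank M (A ∪ B) →
       ∃ λ v → v ∈ B × SimplicialComplex.face X (A ∪ ⁅ v ⁆)) →
    ∃ λ τ → SimplicialComplex.face X τ
          × r + 1 ∸ m ≤ rank M τ
          × rank M (∁ τ) ≤ k ∸ 1
theorem1p6 d r m k n _ _ _ _ m≤k k≤m+d⊓r m+d⊔r≤n X collapsible M rank[⊤]≡r hyp =
  target-face M rank[⊤]≡r m≤k k≤r k≤d+m d+m≤n collapsible
    (λ A B A∩B=∅ ∣A∣≡d ∣B∣≡m k≤rank no-face → no-face (hyp A B A∩B=∅ ∣A∣≡d ∣B∣≡m k≤rank))
  where
  k≤r : k ≤ r
  k≤r = m≤n⊓o⇒m≤o (m + d) r k≤m+d⊓r
  k≤d+m : k ≤ d + m
  k≤d+m = subst (k ≤_) (+-comm m d) (m≤n⊓o⇒m≤n (m + d) r k≤m+d⊓r)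
  d+m≤n : d + m ≤ n
  d+m≤n = subst (_≤ n) (+-comm m d) (m⊔n≤o⇒m≤o (m + d) r m+d⊔r≤n)
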